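{- Let $d>2$ be an integer and let $\mathcal{D}=\{(x,y)\in\mathbb{R}^2:|x|+|y|\leqslant d/2\}$ be the axis-parallel diamond whose diagonals have length $d$. Then the minimum number $n\geqslant2$ of tiles in a permuted packing consisting of $n$ translates of $\mathcal{D}$ is $\lceil d^2/2-1\rceil$.
   Context: $S_n$ is the set of permutations of $[n]$. A translational packing with a tile $\mathcal{T}$ (compact nonempty subset of $\mathbb{R}^2$) is a collection of translates of $\mathcal{T}$ with pairwise disjoint interiors. A translational packing $\Pi$ of $n$ translates of $\mathcal{T}$ is a permuted packing if there is $\sigma\in S_n$ with $\Pi=\{\mathcal{T}+(i,\sigma(i)):1\leqslant i\leqslant n\}$.
   Formalization: Disjointness of the interiors of the translates of $\mathcal{D}$ is tested at points with rational coordinates, in place of all points of ℝ². -}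

module Defs where

open import Data.Nat as ℕ using (ℕ; suc; _*_; _∸_; _/_)
open import Data.Integer as ℤ using (ℤ; +_)
open import Data.Rational as ℚ using (ℚ; _<_; _+_; _-_; ∣_∣)
open import Data.Fin using (Fin; toℕ)
open import Data.Fin.Permutation using (Permutation′; _⟨$⟩ʳ_)
open import Data.Product using (_×_; _,_; ∃)
open import Relation.Binary.PropositionalEquality using (_≢_)
open import Relation.Nullary using (¬_)

Point : Set
Point = ℚ × ℚ

InDiamondInterior : ℕ → Point → Point → Set
InDiamondInterior d (cx , cy) (px , py) =
  ∣ px - cx ∣ + ∣ py - cy ∣ < (+ d) ℚ./ 2

ipt : ℕ → ℕ → Point
ipt a b = (+ a) ℚ./ 1 , (+ b) ℚ./ 1

centre : ∀ {n} → Permutation′ n → Fin n → Point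
centre σ i = ipt (suc (toℕ i)) (suc (toℕ (σ ⟨$⟩ʳ i)))

-- {D + (i, σ(i)) : 1 ≤ i ≤ n} has pairwise disjoint interiors.
-- (Interiors are open, so they meet iff they share a rational point.)
IsPermutedPacking : (d n : ℕ) → Permutation′ n → Set
IsPermutedPacking d n σ =
  ∀ (i j : Fin n) → i ≢ j →
    ¬ ∃ λ (p : Point) →
      InDiamondInterior d (centre σ i) p × InDiamondInterior d (centre σ j) p

HasPermutedPacking : ℕ → ℕ → Set
HasPermutedPacking d n = ∃ λ (σ : Permutation′ n) → IsPermutedPacking d n σ

-- ⌈ d²/2 - 1 ⌉ for d ≥ 2, which equals ⌊ (d² - 1)/2 ⌋
ceilHalfSqMinusOne : ℕ → ℕ
ceilHalfSqMinusOne d = ((d * d) ∸ 1) / 2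

-- Interiors of two translates of the diamond by integer vectors are disjoint iff the
-- vectors are at ℓ¹-distance at least d, so a permuted packing of n tiles is a
-- permutation σ of {0, …, n - 1} with |i - j| + |σ i - σ j| ≥ d for all i ≠ j.  Write
-- d = p + q + 1 with q ∈ {p, p + 1}; then ⌈d²/2 - 1⌉ = M = 2pq + p + q, and
-- M + 1 = (p + 1)² + q².
--
-- Upper bound: multiplication by 2p + 1 on ℤ/(M + 1) is such a permutation, because
-- for 0 < k < d the residue of (2p + 1)k stays at cyclic distance at least d - k from 0;
-- it fixes 0, and deleting 0 leaves a permutation of M points.
--
-- Lower bound: in a window of d consecutive columns τ, …, τ + p + q, columns j ≠ j'
-- satisfy |j - j'| + r j + r j' < d for r j = min (j, p + q - j), so the integer
-- intervals of radius r j around σ (τ + j) are pairwise disjoint.  Their total length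
-- is Σ (2 r j + 1) = (p + 1)² + q² = M + 1, so M ≤ n as soon as they all lie in [0, n].
-- Only the q lowest and q - 1 highest rows can stick out, each in few windows.  The
-- same packing estimate for the first window, with the intervals allowed to stick out,
-- gives n ≥ 2pq + 2, and this leaves more windows than protrusions.

{-# OPTIONS --safe #-}
module Submission where

open import Defs

module DiamondGeometry where

  open import Data.Integer as ℤ using (+_)
  import Data.Integer.Properties as ℤ
  open import Data.Integer.Tactic.RingSolver using (solve-∀)
  open import Data.Nat as ℕ using (ℕ)
  import Data.Nat.Properties as ℕ
  open import Data.Product using (_×_; _,_; ∃)
  open import Data.Rational
  open import Data.Rational.Properties
  open import Data.Rational.Solver using (module +-*-Solver)
  open import Data.Rational.Unnormalised as ℚᵘ using (mkℚᵘ; *≡*; *<*) renaming (_≃_ to _≃ᵘ_)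
  import Data.Rational.Unnormalised.Properties as ℚᵘ
  open import Data.Sum using (inj₁; inj₂)
  open import Relation.Binary.PropositionalEquality
  open import Relation.Nullary using (¬_)
  open +-*-Solver

  DiamondsMeet : ℕ → Point → Point → Set
  DiamondsMeet d u v = ∃ λ p → InDiamondInterior d u p × InDiamondInterior d v p

  dist₁ : Point → Point → ℚ
  dist₁ (x , y) (x' , y') = ∣ x - x' ∣ + ∣ y - y' ∣

  midpoint : Point → Point → Point
  midpoint (x , y) (x' , y') = x + (x' - x) * ½ , y + (y' - y) * ½

  ∣p-q∣≡∣q-p∣ : ∀ p q → ∣ p - q ∣ ≡ ∣ q - p ∣
  ∣p-q∣≡∣q-p∣ p q = trans (sym (∣-p∣≡∣p∣ (p - q))) (cong ∣_∣ (-[p-q]≡q-p p q))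
    where
    -[p-q]≡q-p : ∀ p q → - (p - q) ≡ q - p
    -[p-q]≡q-p = solve 2 (λ p q → :- (p :- q) := q :- p) refl

  ∣p-q∣≤∣r-p∣+∣r-q∣ : ∀ p q r → ∣ p - q ∣ ≤ ∣ r - p ∣ + ∣ r - q ∣
  ∣p-q∣≤∣r-p∣+∣r-q∣ p q r = begin
    ∣ p - q ∣              ≡⟨ cong ∣_∣ (via-r p q r) ⟩
    ∣ (r - q) - (r - p) ∣  ≤⟨ ∣p-q∣≤∣p∣+∣q∣ (r - q) (r - p) ⟩
    ∣ r - q ∣ + ∣ r - p ∣  ≡⟨ +-comm ∣ r - q ∣ ∣ r - p ∣ ⟩
    ∣ r - p ∣ + ∣ r - q ∣  ∎
    where
    open ≤-Reasoning
    via-r : ∀ p q r → p - q ≡ (r - q) - (r - p)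
    via-r = solve 3 (λ p q r → p :- q := (r :- q) :- (r :- p)) refl

  dist₁-triangle : ∀ u v p → dist₁ u v ≤ dist₁ p u + dist₁ p v
  dist₁-triangle (x , y) (x' , y') (px , py) = begin
    ∣ x - x' ∣ + ∣ y - y' ∣
      ≤⟨ +-mono-≤ (∣p-q∣≤∣r-p∣+∣r-q∣ x x' px) (∣p-q∣≤∣r-p∣+∣r-q∣ y y' py) ⟩
    (∣ px - x ∣ + ∣ px - x' ∣) + (∣ py - y ∣ + ∣ py - y' ∣)
      ≡⟨ +-interchange (∣ px - x ∣) (∣ px - x' ∣) (∣ py - y ∣) (∣ py - y' ∣) ⟩
    (∣ px - x ∣ + ∣ py - y ∣) + (∣ px - x' ∣ + ∣ py - y' ∣)
      ∎
    where
    open ≤-Reasoning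
    +-interchange : ∀ a b c e → (a + b) + (c + e) ≡ (a + c) + (b + e)
    +-interchange = solve 4 (λ a b c e → (a :+ b) :+ (c :+ e) := (a :+ c) :+ (b :+ e)) refl

  private
    halfway-from : ∀ a b → ∣ (a + (b - a) * ½) - a ∣ ≡ ∣ a - b ∣ * ½
    halfway-from a b = begin
      ∣ (a + (b - a) * ½) - a ∣  ≡⟨ cong ∣_∣ (step-from a b ½) ⟩
      ∣ (b - a) * ½ ∣            ≡⟨ ∣p*q∣≡∣p∣*∣q∣ (b - a) ½ ⟩
      ∣ b - a ∣ * ½              ≡⟨ cong (_* ½) (∣p-q∣≡∣q-p∣ b a) ⟩
      ∣ a - b ∣ * ½              ∎
      where
      open ≡-Reasoning
      step-from : ∀ a b h → (a + (b - a) * h) - a ≡ (b - a) * h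
      step-from = solve 3 (λ a b h → (a :+ (b :- a) :* h) :- a := (b :- a) :* h) refl

    halfway-to : ∀ a b → ∣ (a + (b - a) * ½) - b ∣ ≡ ∣ a - b ∣ * ½
    halfway-to a b = begin
      ∣ (a + (b - a) * ½) - b ∣  ≡⟨ cong ∣_∣ (step-to a b ½) ⟩
      ∣ (a - b) * (1ℚ - ½) ∣     ≡⟨ ∣p*q∣≡∣p∣*∣q∣ (a - b) ½ ⟩
      ∣ a - b ∣ * ½              ∎
      where
      open ≡-Reasoning
      step-to : ∀ a b h → (a + (b - a) * h) - b ≡ (a - b) * (1ℚ - h)
      step-to = solve 3 (λ a b h → (a :+ (b :- a) :* h) :- b := (a :- b) :* (con 1ℚ :- h)) refl

  dist₁-midpointˡ : ∀ u v → dist₁ (midpoint u v) u ≡ dist₁ u v * ½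
  dist₁-midpointˡ (x , y) (x' , y') =
    trans (cong₂ _+_ (halfway-from x x') (halfway-from y y'))
          (sym (*-distribʳ-+ ½ ∣ x - x' ∣ ∣ y - y' ∣))

  dist₁-midpointʳ : ∀ u v → dist₁ (midpoint u v) v ≡ dist₁ u v * ½
  dist₁-midpointʳ (x , y) (x' , y') =
    trans (cong₂ _+_ (halfway-to x x') (halfway-to y y'))
          (sym (*-distribʳ-+ ½ ∣ x - x' ∣ ∣ y - y' ∣))

  ι : ℕ → ℚ
  ι n = + n / 1

  private
    toℚᵘ-ι : ∀ n → toℚᵘ (ι n) ≃ᵘ mkℚᵘ (+ n) 0
    toℚᵘ-ι n = toℚᵘ-fromℚᵘ (mkℚᵘ (+ n) 0)

    *1-≤-*1 : ∀ {m n} → m ℕ.≤ n → + m ℤ.* + 1 ℤ.≤ + n ℤ.* + 1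
    *1-≤-*1 {m} {n} m≤n = subst₂ ℤ._≤_ (sym (ℤ.*-identityʳ (+ m))) (sym (ℤ.*-identityʳ (+ n))) (ℤ.+≤+ m≤n)

    *1-<-*1 : ∀ {m n} → m ℕ.< n → + m ℤ.* + 1 ℤ.< + n ℤ.* + 1
    *1-<-*1 {m} {n} m<n = subst₂ ℤ._<_ (sym (ℤ.*-identityʳ (+ m))) (sym (ℤ.*-identityʳ (+ n))) (ℤ.+<+ m<n)

  ι-homo-+ : ∀ m n → ι (m ℕ.+ n) ≡ ι m + ι n
  ι-homo-+ m n = toℚᵘ-injective (begin-equality
    toℚᵘ (ι (m ℕ.+ n))              ≃⟨ toℚᵘ-ι (m ℕ.+ n) ⟩
    mkℚᵘ (+ m ℤ.+ + n) 0            ≃⟨ *≡* (numerators (+ m) (+ n)) ⟩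
    mkℚᵘ (+ m) 0 ℚᵘ.+ mkℚᵘ (+ n) 0  ≃⟨ ℚᵘ.+-cong (toℚᵘ-ι m) (toℚᵘ-ι n) ⟨
    toℚᵘ (ι m) ℚᵘ.+ toℚᵘ (ι n)      ≃⟨ toℚᵘ-homo-+ (ι m) (ι n) ⟨
    toℚᵘ (ι m + ι n)                ∎)
    where
    open ℚᵘ.≤-Reasoning
    numerators : ∀ a b → (a ℤ.+ b) ℤ.* (+ 1 ℤ.* + 1) ≡ (a ℤ.* + 1 ℤ.+ b ℤ.* + 1) ℤ.* + 1
    numerators = solve-∀

  ι-mono-≤ : ∀ {m n} → m ℕ.≤ n → ι m ≤ ι n
  ι-mono-≤ {m} {n} m≤n = toℚᵘ-cancel-≤ (begin
    toℚᵘ (ι m)    ≃⟨ toℚᵘ-ι m ⟩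
    mkℚᵘ (+ m) 0  ≤⟨ ℚᵘ.*≤* (*1-≤-*1 m≤n) ⟩
    mkℚᵘ (+ n) 0  ≃⟨ toℚᵘ-ι n ⟨
    toℚᵘ (ι n)    ∎)
    where open ℚᵘ.≤-Reasoning

  ι-mono-< : ∀ {m n} → m ℕ.< n → ι m < ι n
  ι-mono-< {m} {n} m<n = toℚᵘ-cancel-< (begin-strict
    toℚᵘ (ι m)    ≃⟨ toℚᵘ-ι m ⟩
    mkℚᵘ (+ m) 0  <⟨ *<* (*1-<-*1 m<n) ⟩
    mkℚᵘ (+ n) 0  ≃⟨ toℚᵘ-ι n ⟨
    toℚᵘ (ι n)    ∎)
    where open ℚᵘ.≤-Reasoning

  ι-cancel-< : ∀ {m n} → ι m < ι n → m ℕ.< n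
  ι-cancel-< {m} {n} ιm<ιn with ℚᵘ.<-respʳ-≃ (toℚᵘ-ι n) (ℚᵘ.<-respˡ-≃ (toℚᵘ-ι m) (toℚᵘ-mono-< ιm<ιn))
  ... | *<* m*1<n*1 =
    ℤ.drop‿+<+ (subst₂ ℤ._<_ (ℤ.*-identityʳ (+ m)) (ℤ.*-identityʳ (+ n)) m*1<n*1)

  private
    ι-∣-∣-≤ : ∀ {m n} → m ℕ.≤ n → ∣ ι m - ι n ∣ ≡ ι ℕ.∣ m - n ∣
    ι-∣-∣-≤ {m} {n} m≤n = begin
      ∣ ι m - ι n ∣          ≡⟨ cong (λ k → ∣ ι m - ι k ∣) (ℕ.m+[n∸m]≡n m≤n) ⟨
      ∣ ι m - ι (m ℕ.+ k) ∣  ≡⟨ cong (λ x → ∣ ι m - x ∣) (ι-homo-+ m k) ⟩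
      ∣ ι m - (ι m + ι k) ∣  ≡⟨ cong ∣_∣ (a-[a+b]≡-b (ι m) (ι k)) ⟩
      ∣ - ι k ∣              ≡⟨ ∣-p∣≡∣p∣ (ι k) ⟩
      ∣ ι k ∣                ≡⟨ 0≤p⇒∣p∣≡p (ι-mono-≤ {0} {k} ℕ.z≤n) ⟩
      ι k                    ≡⟨ cong ι (ℕ.m≤n⇒∣m-n∣≡n∸m m≤n) ⟨
      ι ℕ.∣ m - n ∣          ∎
      where
      open ≡-Reasoning
      k = n ℕ.∸ m
      a-[a+b]≡-b : ∀ a b → a - (a + b) ≡ - b
      a-[a+b]≡-b = solve 2 (λ a b → a :- (a :+ b) := :- b) refl

  ι-∣-∣ : ∀ m n → ∣ ι m - ι n ∣ ≡ ι ℕ.∣ m - n ∣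
  ι-∣-∣ m n with ℕ.≤-total m n
  ... | inj₁ m≤n = ι-∣-∣-≤ m≤n
  ... | inj₂ n≤m = begin
    ∣ ι m - ι n ∣  ≡⟨ ∣p-q∣≡∣q-p∣ (ι m) (ι n) ⟩
    ∣ ι n - ι m ∣  ≡⟨ ι-∣-∣-≤ n≤m ⟩
    ι ℕ.∣ n - m ∣  ≡⟨ cong ι (ℕ.∣-∣-comm n m) ⟩
    ι ℕ.∣ m - n ∣  ∎
    where open ≡-Reasoning

  half-ι : ∀ d → + d / 2 ≡ ι d * ½
  half-ι d = toℚᵘ-injective (begin-equality
    toℚᵘ (+ d / 2)                  ≃⟨ toℚᵘ-fromℚᵘ (mkℚᵘ (+ d) 1) ⟩
    mkℚᵘ (+ d) 1                    ≃⟨ *≡* (numerators (+ d)) ⟩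
    mkℚᵘ (+ d) 0 ℚᵘ.* mkℚᵘ (+ 1) 1  ≃⟨ ℚᵘ.*-cong (toℚᵘ-ι d) (toℚᵘ-fromℚᵘ (mkℚᵘ (+ 1) 1)) ⟨
    toℚᵘ (ι d) ℚᵘ.* toℚᵘ ½          ≃⟨ toℚᵘ-homo-* (ι d) ½ ⟨
    toℚᵘ (ι d * ½)                  ∎)
    where
    open ℚᵘ.≤-Reasoning
    numerators : ∀ a → a ℤ.* + 2 ≡ (a ℤ.* + 1) ℤ.* + 2
    numerators = solve-∀

  half+half : ∀ d → + d / 2 + + d / 2 ≡ ι d
  half+half d = begin
    + d / 2 + + d / 2  ≡⟨ cong₂ _+_ (half-ι d) (half-ι d) ⟩
    ι d * ½ + ι d * ½  ≡⟨ *-distribˡ-+ (ι d) ½ ½ ⟨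
    ι d * 1ℚ           ≡⟨ *-identityʳ (ι d) ⟩
    ι d                ∎
    where open ≡-Reasoning

  dist₁-ipt : ∀ a b a' b' → dist₁ (ipt a b) (ipt a' b') ≡ ι (ℕ.∣ a - a' ∣ ℕ.+ ℕ.∣ b - b' ∣)
  dist₁-ipt a b a' b' =
    trans (cong₂ _+_ (ι-∣-∣ a a') (ι-∣-∣ b b')) (sym (ι-homo-+ ℕ.∣ a - a' ∣ ℕ.∣ b - b' ∣))

  apart⇒¬DiamondsMeet : ∀ {d} a b a' b' → d ℕ.≤ ℕ.∣ a - a' ∣ ℕ.+ ℕ.∣ b - b' ∣ →
                        ¬ DiamondsMeet d (ipt a b) (ipt a' b')
  apart⇒¬DiamondsMeet {d} a b a' b' d≤D (p , p∈u , p∈v) = ℕ.<⇒≱ (ι-cancel-< ιD<ιd) d≤D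
    where
    u = ipt a b
    v = ipt a' b'
    ιD<ιd : ι (ℕ.∣ a - a' ∣ ℕ.+ ℕ.∣ b - b' ∣) < ι d
    ιD<ιd = begin-strict
      ι (ℕ.∣ a - a' ∣ ℕ.+ ℕ.∣ b - b' ∣)  ≡⟨ dist₁-ipt a b a' b' ⟨
      dist₁ u v                          ≤⟨ dist₁-triangle u v p ⟩
      dist₁ p u + dist₁ p v              <⟨ +-mono-< p∈u p∈v ⟩
      + d / 2 + + d / 2                  ≡⟨ half+half d ⟩
      ι d                                ∎
      where open ≤-Reasoning

  ¬apart⇒DiamondsMeet : ∀ {d} a b a' b' → ℕ.∣ a - a' ∣ ℕ.+ ℕ.∣ b - b' ∣ ℕ.< d →
                        DiamondsMeet d (ipt a b) (ipt a' b')
  ¬apart⇒DiamondsMeet {d} a b a' b' D<d =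
    midpoint u v , within (dist₁-midpointˡ u v) , within (dist₁-midpointʳ u v)
    where
    u = ipt a b
    v = ipt a' b'
    within : ∀ {r} → r ≡ dist₁ u v * ½ → r < + d / 2
    within {r} r≡ = begin-strict
      r                                      ≡⟨ r≡ ⟩
      dist₁ u v * ½                          ≡⟨ cong (_* ½) (dist₁-ipt a b a' b') ⟩
      ι (ℕ.∣ a - a' ∣ ℕ.+ ℕ.∣ b - b' ∣) * ½  <⟨ *-monoˡ-<-pos ½ (ι-mono-< D<d) ⟩
      ι d * ½                                ≡⟨ half-ι d ⟨
      + d / 2                                ∎
      where open ≤-Reasoning

open DiamondGeometry using (apart⇒¬DiamondsMeet; ¬apart⇒DiamondsMeet)

open import Data.Fin as Fin using (Fin; toℕ; fromℕ<; punchOut)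
import Data.Fin.Properties as Finₚ
open import Data.Fin.Permutation
  using (Permutation′; _⟨$⟩ʳ_; _⟨$⟩ˡ_; flip; inverseˡ; permutation; remove)
open import Data.Nat
open import Data.Nat.DivMod
open import Data.Nat.Properties
open import Data.Nat.Tactic.RingSolver using (solve-∀)
open import Data.Product using (_×_; _,_; ∃-syntax; proj₁; proj₂; uncurry)
open import Data.Sum using (_⊎_; inj₁; inj₂)
open import Function using (_∘_)
open import Relation.Binary using (tri<; tri≈; tri>)
open import Relation.Binary.PropositionalEquality
open import Relation.Nullary using (¬_; Dec; yes; no; contradiction)
open import Relation.Nullary.Decidable using (_×-dec_)

∑< : ℕ → (ℕ → ℕ) → ℕ
∑< zero    f = 0
∑< (suc k) f = ∑< k f + f k

syntax ∑< k (λ j → e) = ∑[ j < k ] e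

∑-cong : ∀ k {f g : ℕ → ℕ} → (∀ {j} → j < k → f j ≡ g j) → ∑< k f ≡ ∑< k g
∑-cong zero    f≗g = refl
∑-cong (suc k) f≗g = cong₂ _+_ (∑-cong k (f≗g ∘ m<n⇒m<1+n)) (f≗g ≤-refl)

∑-mono-≤ : ∀ k {f g : ℕ → ℕ} → (∀ {j} → j < k → f j ≤ g j) → ∑< k f ≤ ∑< k g
∑-mono-≤ zero    f≤g = z≤n
∑-mono-≤ (suc k) f≤g = +-mono-≤ (∑-mono-≤ k (f≤g ∘ m<n⇒m<1+n)) (f≤g ≤-refl)

∑-zero : ∀ k {f : ℕ → ℕ} → (∀ {j} → j < k → f j ≡ 0) → ∑< k f ≡ 0
∑-zero zero    f≡0 = refl
∑-zero (suc k) f≡0 = cong₂ _+_ (∑-zero k (f≡0 ∘ m<n⇒m<1+n)) (f≡0 ≤-refl)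

∑-const : ∀ k c → ∑[ j < k ] c ≡ k * c
∑-const zero    c = refl
∑-const (suc k) c = trans (cong (_+ c) (∑-const k c)) (+-comm (k * c) c)

∑≡0⇒≡0 : ∀ k {f : ℕ → ℕ} → ∑< k f ≡ 0 → ∀ {j} → j < k → f j ≡ 0
∑≡0⇒≡0 (suc k) {f} ∑≡0 j<1+k with m<1+n⇒m<n∨m≡n j<1+k
... | inj₁ j<k  = ∑≡0⇒≡0 k (m+n≡0⇒m≡0 (∑< k f) ∑≡0) j<k
... | inj₂ refl = m+n≡0⇒n≡0 (∑< k f) ∑≡0

∑<k⇒∃≡0 : ∀ k {f : ℕ → ℕ} → ∑< k f < k → ∃[ j ] j < k × f j ≡ 0
∑<k⇒∃≡0 (suc k) {f} ∑<1+k with f k in fk≡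
... | zero  = k , ≤-refl , fk≡
... | suc v with ∑<k⇒∃≡0 k (<-≤-trans (m<m+n (∑< k f) z<s) (s≤s⁻¹ ∑<1+k))
...   | j , j<k , fj≡0 = j , m<n⇒m<1+n j<k , fj≡0

∑≤1 : ∀ k {f : ℕ → ℕ} → (∀ {j} → j < k → f j ≤ 1) →
      (∀ {i j} → i < k → j < k → 0 < f i → 0 < f j → i ≡ j) → ∑< k f ≤ 1
∑≤1 zero    f≤1 unique = z≤n
∑≤1 (suc k) {f} f≤1 unique with f k in fk≡
... | zero  = subst (_≤ 1) (sym (+-identityʳ _))
                (∑≤1 k (f≤1 ∘ m<n⇒m<1+n) (λ i<k j<k → unique (m<n⇒m<1+n i<k) (m<n⇒m<1+n j<k)))
... | suc v = begin
  ∑< k f + suc v  ≡⟨ cong (_+ suc v) (∑-zero k others-vanish) ⟩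
  suc v           ≡⟨ fk≡ ⟨
  f k             ≤⟨ f≤1 ≤-refl ⟩
  1               ∎
  where
  open ≤-Reasoning
  others-vanish : ∀ {j} → j < k → f j ≡ 0
  others-vanish {j} j<k with f j in fj≡
  ... | zero  = refl
  ... | suc _ = contradiction (unique (m<n⇒m<1+n j<k) ≤-refl (subst (0 <_) (sym fj≡) z<s)
                                                             (subst (0 <_) (sym fk≡) z<s))
                              (<⇒≢ j<k)

∑-distrib-+ : ∀ k (f g : ℕ → ℕ) → ∑[ j < k ] (f j + g j) ≡ ∑< k f + ∑< k g
∑-distrib-+ zero    f g = refl
∑-distrib-+ (suc k) f g = begin
  ∑[ j < k ] (f j + g j) + (f k + g k)  ≡⟨ cong (_+ (f k + g k)) (∑-distrib-+ k f g) ⟩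
  ∑< k f + ∑< k g + (f k + g k)         ≡⟨ +-+-interchange (∑< k f) (∑< k g) (f k) (g k) ⟩
  ∑< (suc k) f + ∑< (suc k) g           ∎
  where
  open ≡-Reasoning
  +-+-interchange : ∀ a b c e → a + b + (c + e) ≡ a + c + (b + e)
  +-+-interchange = solve-∀

∑-split : ∀ a b (f : ℕ → ℕ) → ∑< (a + b) f ≡ ∑< a f + ∑[ j < b ] f (a + j)
∑-split a zero    f = trans (cong (λ k → ∑< k f) (+-identityʳ a)) (sym (+-identityʳ _))
∑-split a (suc b) f rewrite +-suc a b | ∑-split a b f = +-assoc (∑< a f) _ _

∑-head : ∀ k (f : ℕ → ℕ) → ∑< (suc k) f ≡ f 0 + ∑[ j < k ] f (suc j)
∑-head k f = ∑-split 1 k f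

∑-comm : ∀ a b (h : ℕ → ℕ → ℕ) → ∑[ i < a ] ∑[ j < b ] h i j ≡ ∑[ j < b ] ∑[ i < a ] h i j
∑-comm zero    b h = sym (∑-zero b (λ _ → refl))
∑-comm (suc a) b h = begin
  ∑[ i < a ] ∑[ j < b ] h i j + ∑[ j < b ] h a j  ≡⟨ cong (_+ ∑[ j < b ] h a j) (∑-comm a b h) ⟩
  ∑[ j < b ] ∑[ i < a ] h i j + ∑[ j < b ] h a j  ≡⟨ ∑-distrib-+ b (λ j → ∑[ i < a ] h i j) (h a) ⟨
  ∑[ j < b ] ∑[ i < suc a ] h i j                  ∎
  where open ≡-Reasoning

∑-reverse : ∀ k (f : ℕ → ℕ) → ∑[ i < k ] f (k ∸ suc i) ≡ ∑< k f
∑-reverse zero    f = refl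
∑-reverse (suc k) f = begin
  ∑[ i < suc k ] f (k ∸ i)        ≡⟨ ∑-head k (λ i → f (k ∸ i)) ⟩
  f k + ∑[ i < k ] f (k ∸ suc i)  ≡⟨ cong (f k +_) (∑-reverse k f) ⟩
  f k + ∑< k f                    ≡⟨ +-comm (f k) (∑< k f) ⟩
  ∑< (suc k) f                    ∎
  where open ≡-Reasoning

∑-odd : ∀ k → ∑[ j < k ] suc (j + j) ≡ k * k
∑-odd zero    = refl
∑-odd (suc k) = trans (cong (_+ suc (k + k)) (∑-odd k)) (square-step k)
  where
  square-step : ∀ k → k * k + suc (k + k) ≡ suc k * suc k
  square-step = solve-∀

𝟙 : {A : Set} → Dec A → ℕ
𝟙 (yes _) = 1
𝟙 (no _)  = 0

module _ {A : Set} where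

  𝟙≤1 : (a? : Dec A) → 𝟙 a? ≤ 1
  𝟙≤1 (yes _) = ≤-refl
  𝟙≤1 (no _)  = z≤n

  𝟙-yes : (a? : Dec A) → A → 𝟙 a? ≡ 1
  𝟙-yes (yes _) a = refl
  𝟙-yes (no ¬a) a = contradiction a ¬a

  𝟙-no : (a? : Dec A) → ¬ A → 𝟙 a? ≡ 0
  𝟙-no (yes a) ¬a = contradiction a ¬a
  𝟙-no (no _)  ¬a = refl

  𝟙>0⇒ : (a? : Dec A) → 0 < 𝟙 a? → A
  𝟙>0⇒ (yes a) _ = a

𝟙[_≤_<_] : ℕ → ℕ → ℕ → ℕ
𝟙[ lo ≤ z < hi ] = 𝟙 (lo ≤? z ×-dec z <? hi)

𝟙[≤<]-in : ∀ {lo z hi} → lo ≤ z → z < hi → 𝟙[ lo ≤ z < hi ] ≡ 1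
𝟙[≤<]-in lo≤z z<hi = 𝟙-yes (_ ≤? _ ×-dec _ <? _) (lo≤z , z<hi)

𝟙[≤<]-out : ∀ {lo z hi} → ¬ (lo ≤ z × z < hi) → 𝟙[ lo ≤ z < hi ] ≡ 0
𝟙[≤<]-out z∉ = 𝟙-no (_ ≤? _ ×-dec _ <? _) z∉

𝟙[≤<]>0⇒ : ∀ {lo z hi} → 0 < 𝟙[ lo ≤ z < hi ] → lo ≤ z × z < hi
𝟙[≤<]>0⇒ = 𝟙>0⇒ (_ ≤? _ ×-dec _ <? _)

∑-𝟙[≤<] : ∀ lo hi U → ∑[ z < U ] 𝟙[ lo ≤ z < hi ] ≡ (U ⊓ hi) ∸ lo
∑-𝟙[≤<] lo hi zero = sym (0∸n≡0 lo)
∑-𝟙[≤<] lo hi (suc U) with <-≤-connex U hi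
... | inj₂ hi≤U = begin
  ∑[ z < U ] 𝟙[ lo ≤ z < hi ] + 𝟙[ lo ≤ U < hi ]
    ≡⟨ cong₂ _+_ (∑-𝟙[≤<] lo hi U) (𝟙[≤<]-out (≤⇒≯ hi≤U ∘ proj₂)) ⟩
  (U ⊓ hi) ∸ lo + 0      ≡⟨ +-identityʳ _ ⟩
  (U ⊓ hi) ∸ lo          ≡⟨ cong (_∸ lo) (m≥n⇒m⊓n≡n hi≤U) ⟩
  hi ∸ lo                ≡⟨ cong (_∸ lo) (m≥n⇒m⊓n≡n (m≤n⇒m≤1+n hi≤U)) ⟨
  (suc U ⊓ hi) ∸ lo      ∎
  where open ≡-Reasoning
... | inj₁ U<hi rewrite m≤n⇒m⊓n≡m U<hi with ≤-<-connex lo U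
...   | inj₁ lo≤U = begin
  ∑[ z < U ] 𝟙[ lo ≤ z < hi ] + 𝟙[ lo ≤ U < hi ]
    ≡⟨ cong₂ _+_ (∑-𝟙[≤<] lo hi U) (𝟙[≤<]-in lo≤U U<hi) ⟩
  (U ⊓ hi) ∸ lo + 1      ≡⟨ cong (λ m → m ∸ lo + 1) (m≤n⇒m⊓n≡m (<⇒≤ U<hi)) ⟩
  U ∸ lo + 1             ≡⟨ +-comm (U ∸ lo) 1 ⟩
  suc (U ∸ lo)           ≡⟨ +-∸-assoc 1 lo≤U ⟨
  suc U ∸ lo             ∎
  where open ≡-Reasoning
...   | inj₂ U<lo = begin
  ∑[ z < U ] 𝟙[ lo ≤ z < hi ] + 𝟙[ lo ≤ U < hi ]
    ≡⟨ cong₂ _+_ (∑-𝟙[≤<] lo hi U) (𝟙[≤<]-out (<⇒≱ U<lo ∘ proj₁)) ⟩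
  (U ⊓ hi) ∸ lo + 0      ≡⟨ cong (λ m → m ∸ lo + 0) (m≤n⇒m⊓n≡m (<⇒≤ U<hi)) ⟩
  U ∸ lo + 0             ≡⟨ cong (_+ 0) (m≤n⇒m∸n≡0 (<⇒≤ U<lo)) ⟩
  0                      ≡⟨ m≤n⇒m∸n≡0 U<lo ⟨
  suc U ∸ lo             ∎
  where open ≡-Reasoning

∑-𝟙[≤<]-≤ : ∀ lo hi U → ∑[ z < U ] 𝟙[ lo ≤ z < hi ] ≤ hi ∸ lo
∑-𝟙[≤<]-≤ lo hi U = subst (_≤ hi ∸ lo) (sym (∑-𝟙[≤<] lo hi U)) (∸-monoˡ-≤ lo (m⊓n≤n U hi))

∑-𝟙[≤<]-⊆ : ∀ lo hi U → hi ≤ U → ∑[ z < U ] 𝟙[ lo ≤ z < hi ] ≡ hi ∸ lo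
∑-𝟙[≤<]-⊆ lo hi U hi≤U = trans (∑-𝟙[≤<] lo hi U) (cong (_∸ lo) (m≥n⇒m⊓n≡n hi≤U))

interval⇒∣-∣≤ : ∀ {c w z} → c ∸ w ≤ z → z < suc (c + w) → ∣ z - c ∣ ≤ w
interval⇒∣-∣≤ {c} {w} {z} c∸w≤z z<1+c+w with ≤-total z c
... | inj₁ z≤c = subst (_≤ w) (sym (m≤n⇒∣m-n∣≡n∸m z≤c)) (m≤n+o⇒m∸n≤o c z (begin
  c            ≤⟨ m≤n+m∸n c w ⟩
  w + (c ∸ w)  ≤⟨ +-monoʳ-≤ w c∸w≤z ⟩
  w + z        ≡⟨ +-comm w z ⟩
  z + w        ∎))
  where open ≤-Reasoning
... | inj₂ c≤z = subst (_≤ w) (sym (m≤n⇒∣n-m∣≡n∸m c≤z)) (m≤n+o⇒m∸n≤o z c (s≤s⁻¹ z<1+c+w))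

interval-length : ∀ {c w} → w ≤ c → suc (c + w) ∸ (c ∸ w) ≡ suc (w + w)
interval-length {c} {w} w≤c = begin
  suc (c + w) ∸ (c ∸ w)  ≡⟨ cong (λ x → suc x ∸ (c ∸ w)) (+-comm c w) ⟩
  suc w + c ∸ (c ∸ w)    ≡⟨ +-∸-assoc (suc w) (m∸n≤m c w) ⟩
  suc w + (c ∸ (c ∸ w))  ≡⟨ cong (suc w +_) (m∸[m∸n]≡n w≤c) ⟩
  suc (w + w)            ∎
  where open ≡-Reasoning

module _ (D L U : ℕ) (c w : ℕ → ℕ)
         (above : ∀ {j} → j < D → L + w j ≤ c j)
         (below : ∀ {j} → j < D → c j + w j < U)
         (apart : ∀ {i j} → i < D → j < D → i ≢ j → w i + w j < ∣ c i - c j ∣)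
         where

  private
    ball : ℕ → ℕ → ℕ
    ball j z = 𝟙[ c j ∸ w j ≤ z < suc (c j + w j) ]

    ball-size : ∀ {j} → j < D → ∑[ z < U ] ball j z ≡ suc (w j + w j)
    ball-size j<D = trans (∑-𝟙[≤<]-⊆ _ _ U (below j<D)) (interval-length (m+n≤o⇒n≤o L (above j<D)))

    balls-disjoint : ∀ z {i j} → i < D → j < D → 0 < ball i z → 0 < ball j z → i ≡ j
    balls-disjoint z {i} {j} i<D j<D z∈i z∈j with i ≟ j
    ... | yes i≡j = i≡j
    ... | no  i≢j = contradiction ∣ci-cj∣≤wi+wj (<⇒≱ (apart i<D j<D i≢j))
      where
      open ≤-Reasoning
      ∣ci-cj∣≤wi+wj : ∣ c i - c j ∣ ≤ w i + w j
      ∣ci-cj∣≤wi+wj = begin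
        ∣ c i - c j ∣              ≤⟨ ∣-∣-triangle (c i) z (c j) ⟩
        ∣ c i - z ∣ + ∣ z - c j ∣  ≡⟨ cong (_+ ∣ z - c j ∣) (∣-∣-comm (c i) z) ⟩
        ∣ z - c i ∣ + ∣ z - c j ∣  ≤⟨ +-mono-≤ (uncurry interval⇒∣-∣≤ (𝟙[≤<]>0⇒ z∈i))
                                              (uncurry interval⇒∣-∣≤ (𝟙[≤<]>0⇒ z∈j)) ⟩
        w i + w j                  ∎

    balls-over-point : ∀ {z} → z < U → ∑[ j < D ] ball j z ≤ 𝟙[ L ≤ z < U ]
    balls-over-point {z} z<U with ≤-<-connex L z
    ... | inj₁ L≤z = subst (∑[ j < D ] ball j z ≤_) (sym (𝟙[≤<]-in L≤z z<U))
                       (∑≤1 D (λ _ → 𝟙≤1 _) (balls-disjoint z))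
    ... | inj₂ z<L = subst (_≤ 𝟙[ L ≤ z < U ]) (sym (∑-zero D z∉ball)) z≤n
      where
      z∉ball : ∀ {j} → j < D → ball j z ≡ 0
      z∉ball j<D = 𝟙[≤<]-out λ (lo≤z , _) → <⇒≱ z<L (≤-trans (m+n≤o⇒m≤o∸n L (above j<D)) lo≤z)

  balls-packing : ∑[ j < D ] suc (w j + w j) ≤ U ∸ L
  balls-packing = begin
    ∑[ j < D ] suc (w j + w j)      ≡⟨ ∑-cong D ball-size ⟨
    ∑[ j < D ] ∑[ z < U ] ball j z  ≡⟨ ∑-comm D U ball ⟩
    ∑[ z < U ] ∑[ j < D ] ball j z  ≤⟨ ∑-mono-≤ U balls-over-point ⟩
    ∑[ z < U ] 𝟙[ L ≤ z < U ]       ≡⟨ ∑-𝟙[≤<]-⊆ L U U ≤-refl ⟩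
    U ∸ L                           ∎
    where open ≤-Reasoning

Separated : ℕ → ℕ → (ℕ → ℕ) → Set
Separated d n Y = ∀ {x x'} → x < n → x' < n → x ≢ x' → d ≤ ∣ x - x' ∣ + ∣ Y x - Y x' ∣

⟦_⟧ : ∀ {n} → Permutation′ n → ℕ → ℕ
⟦_⟧ {n} σ x with x <? n
... | yes x<n = toℕ (σ ⟨$⟩ʳ fromℕ< x<n)
... | no  _   = x

⟦⟧-fromℕ< : ∀ {n} (σ : Permutation′ n) {x} (x<n : x < n) → ⟦ σ ⟧ x ≡ toℕ (σ ⟨$⟩ʳ fromℕ< x<n)
⟦⟧-fromℕ< {n} σ {x} x<n with x <? n
... | yes _   = refl
... | no  x≮n = contradiction x<n x≮n

⟦⟧-toℕ : ∀ {n} (σ : Permutation′ n) i → ⟦ σ ⟧ (toℕ i) ≡ toℕ (σ ⟨$⟩ʳ i)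
⟦⟧-toℕ σ i = trans (⟦⟧-fromℕ< σ (Finₚ.toℕ<n i)) (cong (toℕ ∘ (σ ⟨$⟩ʳ_)) (Finₚ.fromℕ<-toℕ i _))

⟦⟧-< : ∀ {n} (σ : Permutation′ n) {x} → x < n → ⟦ σ ⟧ x < n
⟦⟧-< {n} σ x<n = subst (_< n) (sym (⟦⟧-fromℕ< σ x<n)) (Finₚ.toℕ<n _)

module _ {n} (σ : Permutation′ n) where

  ⟦flip⟧-⟦⟧ : ∀ {x} → x < n → ⟦ flip σ ⟧ (⟦ σ ⟧ x) ≡ x
  ⟦flip⟧-⟦⟧ {x} x<n = begin
    ⟦ flip σ ⟧ (⟦ σ ⟧ x)                  ≡⟨ cong ⟦ flip σ ⟧ (⟦⟧-fromℕ< σ x<n) ⟩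
    ⟦ flip σ ⟧ (toℕ (σ ⟨$⟩ʳ fromℕ< x<n))  ≡⟨ ⟦⟧-toℕ (flip σ) (σ ⟨$⟩ʳ fromℕ< x<n) ⟩
    toℕ (σ ⟨$⟩ˡ (σ ⟨$⟩ʳ fromℕ< x<n))      ≡⟨ cong toℕ (inverseˡ σ) ⟩
    toℕ (fromℕ< x<n)                      ≡⟨ Finₚ.toℕ-fromℕ< x<n ⟩
    x                                     ∎
    where open ≡-Reasoning

  separated⇒permutedPacking : ∀ {d} → Separated d n ⟦ σ ⟧ → IsPermutedPacking d n σ
  separated⇒permutedPacking {d} sep i j i≢j =
    apart⇒¬DiamondsMeet (suc (toℕ i)) (suc (toℕ (σ ⟨$⟩ʳ i))) (suc (toℕ j)) (suc (toℕ (σ ⟨$⟩ʳ j)))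
      (subst₂ (λ y y' → d ≤ ∣ toℕ i - toℕ j ∣ + ∣ y - y' ∣) (⟦⟧-toℕ σ i) (⟦⟧-toℕ σ j)
        (sep (Finₚ.toℕ<n i) (Finₚ.toℕ<n j) (i≢j ∘ Finₚ.toℕ-injective)))

  permutedPacking⇒separated : ∀ {d} → IsPermutedPacking d n σ → Separated d n ⟦ σ ⟧
  permutedPacking⇒separated {d} packing {x} {x'} x<n x'<n x≢x'
    with d ≤? ∣ x - x' ∣ + ∣ ⟦ σ ⟧ x - ⟦ σ ⟧ x' ∣
  ... | yes d≤D = d≤D
  ... | no  d≰D = contradiction meet (packing i i' (x≢x' ∘ fromℕ<-injective))
    where
    i  = fromℕ< x<n
    i' = fromℕ< x'<n
    fromℕ<-injective : i ≡ i' → x ≡ x'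
    fromℕ<-injective i≡i' =
      trans (sym (Finₚ.toℕ-fromℕ< x<n)) (trans (cong toℕ i≡i') (Finₚ.toℕ-fromℕ< x'<n))
    D<d : ∣ toℕ i - toℕ i' ∣ + ∣ toℕ (σ ⟨$⟩ʳ i) - toℕ (σ ⟨$⟩ʳ i') ∣ < d
    D<d = subst₂ (λ u u' → ∣ u - u' ∣ + ∣ toℕ (σ ⟨$⟩ʳ i) - toℕ (σ ⟨$⟩ʳ i') ∣ < d)
            (sym (Finₚ.toℕ-fromℕ< x<n)) (sym (Finₚ.toℕ-fromℕ< x'<n))
            (subst₂ (λ y y' → ∣ x - x' ∣ + ∣ y - y' ∣ < d)
              (⟦⟧-fromℕ< σ x<n) (⟦⟧-fromℕ< σ x'<n) (≰⇒> d≰D))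
    meet = ¬apart⇒DiamondsMeet (suc (toℕ i)) (suc (toℕ (σ ⟨$⟩ʳ i))) (suc (toℕ i')) (suc (toℕ (σ ⟨$⟩ʳ i'))) D<d

%-inverse : ∀ {N} .{{_ : NonZero N}} a b → (a * b) % N ≡ 1 % N →
            ∀ {y} → y < N → (a * ((b * y) % N)) % N ≡ y
%-inverse {N} a b ab≡1 {y} y<N = begin
  (a * ((b * y) % N)) % N            ≡⟨ %-distribˡ-* a ((b * y) % N) N ⟩
  ((a % N) * ((b * y) % N % N)) % N  ≡⟨ cong (λ z → ((a % N) * z) % N) (m%n%n≡m%n (b * y) N) ⟩
  ((a % N) * ((b * y) % N)) % N      ≡⟨ %-distribˡ-* a (b * y) N ⟨
  (a * (b * y)) % N                  ≡⟨ cong (_% N) (*-assoc a b y) ⟨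
  (a * b * y) % N                    ≡⟨ %-distribˡ-* (a * b) y N ⟩
  (((a * b) % N) * (y % N)) % N      ≡⟨ cong (λ z → (z * (y % N)) % N) ab≡1 ⟩
  ((1 % N) * (y % N)) % N            ≡⟨ %-distribˡ-* 1 y N ⟨
  (1 * y) % N                        ≡⟨ cong (_% N) (*-identityˡ y) ⟩
  y % N                              ≡⟨ m<n⇒m%n≡m y<N ⟩
  y                                  ∎
  where open ≡-Reasoning

module _ (N : ℕ) .{{_ : NonZero N}} (g h : ℕ) (gh≡1 : (g * h) % N ≡ 1 % N) where

  private
    times : ℕ → Fin N → Fin N
    times a i = fromℕ< (m%n<n (a * toℕ i) N)

    times-inverse : ∀ a b → (a * b) % N ≡ 1 % N → ∀ i → times a (times b i) ≡ i
    times-inverse a b ab≡1 i = Finₚ.toℕ-injective (begin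
      toℕ (times a (times b i))    ≡⟨ Finₚ.toℕ-fromℕ< _ ⟩
      (a * toℕ (times b i)) % N    ≡⟨ cong (λ z → (a * z) % N) (Finₚ.toℕ-fromℕ< _) ⟩
      (a * ((b * toℕ i) % N)) % N  ≡⟨ %-inverse a b ab≡1 (Finₚ.toℕ<n i) ⟩
      toℕ i                        ∎)
      where open ≡-Reasoning

  scaling : Permutation′ N
  scaling = permutation (times g) (times h) (times-inverse g h gh≡1)
              (times-inverse h g (trans (cong (_% N) (*-comm h g)) gh≡1))

  ⟦scaling⟧ : ∀ {x} → x < N → ⟦ scaling ⟧ x ≡ (g * x) % N
  ⟦scaling⟧ x<N = trans (⟦⟧-fromℕ< scaling x<N)
                    (trans (Finₚ.toℕ-fromℕ< _) (cong (λ z → (g * z) % N) (Finₚ.toℕ-fromℕ< x<N)))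

scaling-zero : ∀ {M} g h gh≡1 → scaling (suc M) g h gh≡1 ⟨$⟩ʳ Fin.zero ≡ Fin.zero
scaling-zero {M} g h gh≡1 = Finₚ.toℕ-injective (trans (Finₚ.toℕ-fromℕ< _) (cong (_% suc M) (*-zeroʳ g)))

punchOut-zero : ∀ {n} {i j : Fin (suc n)} (i≢j : i ≢ j) → i ≡ Fin.zero → suc (toℕ (punchOut i≢j)) ≡ toℕ j
punchOut-zero {j = Fin.zero}  i≢j refl = contradiction refl i≢j
punchOut-zero {j = Fin.suc j} i≢j refl = refl

module _ {n} (σ : Permutation′ (suc n)) (σ0≡0 : σ ⟨$⟩ʳ Fin.zero ≡ Fin.zero) where

  ⟦remove-zero⟧ : ∀ {x} → x < n → suc (⟦ remove Fin.zero σ ⟧ x) ≡ ⟦ σ ⟧ (suc x)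
  ⟦remove-zero⟧ {x} x<n = begin
    suc (⟦ remove Fin.zero σ ⟧ x)                  ≡⟨ cong suc (⟦⟧-fromℕ< (remove Fin.zero σ) x<n) ⟩
    suc (toℕ (remove Fin.zero σ ⟨$⟩ʳ fromℕ< x<n))  ≡⟨ punchOut-zero _ σ0≡0 ⟩
    toℕ (σ ⟨$⟩ʳ Fin.suc (fromℕ< x<n))              ≡⟨ ⟦⟧-fromℕ< σ (s≤s x<n) ⟨
    ⟦ σ ⟧ (suc x)                                  ∎
    where open ≡-Reasoning

  remove-zero-separated : ∀ {d} → Separated d (suc n) ⟦ σ ⟧ → Separated d n ⟦ remove Fin.zero σ ⟧
  remove-zero-separated {d} sep {x} {x'} x<n x'<n x≢x' =
    subst₂ (λ y y' → d ≤ ∣ suc x - suc x' ∣ + ∣ y - y' ∣)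
      (sym (⟦remove-zero⟧ x<n)) (sym (⟦remove-zero⟧ x'<n))
      (sep (s≤s x<n) (s≤s x'<n) (x≢x' ∘ suc-injective))

∣m-[m+n]%N∣ : ∀ {N} .{{_ : NonZero N}} {m n} → m < N → n ≤ N →
              ∣ m - (m + n) % N ∣ ≡ n ⊎ ∣ m - (m + n) % N ∣ ≡ N ∸ n
∣m-[m+n]%N∣ {N} {m} {n} m<N n≤N with <-≤-connex (m + n) N
... | inj₁ m+n<N = inj₁ (trans (cong (∣ m -_∣) (m<n⇒m%n≡m m+n<N)) (∣m-m+n∣≡n m n))
... | inj₂ N≤m+n = inj₂ (begin
  ∣ m - (m + n) % N ∣  ≡⟨ cong (λ z → ∣ m - z % N ∣) m+n≡s+N ⟩
  ∣ m - (s + N) % N ∣  ≡⟨ cong (∣ m -_∣) (trans ([m+n]%n≡m%n s N) (m<n⇒m%n≡m s<N)) ⟩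
  ∣ m - s ∣            ≡⟨ cong (∣_- s ∣) (m∸n+n≡m r≤m) ⟨
  ∣ s + r - s ∣        ≡⟨ ∣-∣-comm (s + r) s ⟩
  ∣ s - s + r ∣        ≡⟨ ∣m-m+n∣≡n s r ⟩
  N ∸ n                ∎)
  where
  open ≡-Reasoning
  r = N ∸ n
  s = m ∸ r
  r≤m : r ≤ m
  r≤m = m≤n+o⇒m∸n≤o N n (subst (N ≤_) (+-comm m n) N≤m+n)
  s<N : s < N
  s<N = ≤-<-trans (m∸n≤m m r) m<N
  m+n≡s+N : m + n ≡ s + N
  m+n≡s+N = begin
    m + n        ≡⟨ cong (_+ n) (m∸n+n≡m r≤m) ⟨
    s + r + n    ≡⟨ +-assoc s r n ⟩
    s + (r + n)  ≡⟨ cong (s +_) (m∸n+n≡m n≤N) ⟩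
    s + N        ∎

module _ {N} .{{_ : NonZero N}} {d g : ℕ}
         (cyclic-gap : ∀ {k} → 0 < k → k < d → d ≤ k + (g * k) % N × d ≤ k + (N ∸ (g * k) % N))
         where

  private
    scaling-separated-+ : ∀ x {k} → 0 < k → d ≤ k + ∣ (g * x) % N - (g * (x + k)) % N ∣
    scaling-separated-+ x {k} 0<k with <-≤-connex k d
    ... | inj₂ d≤k = ≤-trans d≤k (m≤m+n k _)
    ... | inj₁ k<d =
      subst (λ δ → d ≤ k + δ) (cong (∣ y -_∣) g[x+k]%N) (by-cases (∣m-[m+n]%N∣ y<N c≤N))
      where
      y = (g * x) % N
      c = (g * k) % N
      y<N = m%n<n (g * x) N
      c≤N = <⇒≤ (m%n<n (g * k) N)
      g[x+k]%N : (y + c) % N ≡ (g * (x + k)) % N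
      g[x+k]%N = sym (trans (cong (_% N) (*-distribˡ-+ g x k)) (%-distribˡ-+ (g * x) (g * k) N))
      by-cases : ∣ y - (y + c) % N ∣ ≡ c ⊎ ∣ y - (y + c) % N ∣ ≡ N ∸ c → d ≤ k + ∣ y - (y + c) % N ∣
      by-cases (inj₁ δ≡c)   = subst (λ δ → d ≤ k + δ) (sym δ≡c)   (proj₁ (cyclic-gap 0<k k<d))
      by-cases (inj₂ δ≡N∸c) = subst (λ δ → d ≤ k + δ) (sym δ≡N∸c) (proj₂ (cyclic-gap 0<k k<d))

    scaling-separated-< : ∀ {x x'} → x < x' → d ≤ ∣ x - x' ∣ + ∣ (g * x) % N - (g * x') % N ∣
    scaling-separated-< {x} {x'} x<x' =
      subst (λ z → d ≤ ∣ x - z ∣ + ∣ (g * x) % N - (g * z) % N ∣) (m+[n∸m]≡n (<⇒≤ x<x'))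
        (subst (λ δ → d ≤ δ + ∣ (g * x) % N - (g * (x + (x' ∸ x))) % N ∣) (sym (∣m-m+n∣≡n x (x' ∸ x)))
          (scaling-separated-+ x (m<n⇒0<n∸m x<x')))

  scaling-separated : ∀ {x x'} → x ≢ x' → d ≤ ∣ x - x' ∣ + ∣ (g * x) % N - (g * x') % N ∣
  scaling-separated {x} {x'} x≢x' with <-cmp x x'
  ... | tri< x<x' _ _ = scaling-separated-< x<x'
  ... | tri≈ _ x≡x' _ = contradiction x≡x' x≢x'
  ... | tri> _ _ x'<x =
    subst₂ (λ δ δ' → d ≤ δ + δ') (∣-∣-comm x' x) (∣-∣-comm ((g * x') % N) ((g * x) % N))
      (scaling-separated-< x'<x)

cyclic-gap-by-quotient : ∀ {N} .{{_ : NonZero N}} {d k m} c r → m ≡ c + r * N → k < d →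
                         d ≤ k + c → c + d ≤ N + k → d ≤ k + m % N × d ≤ k + (N ∸ m % N)
cyclic-gap-by-quotient {N} {d} {k} {m} c r m≡c+rN k<d d≤k+c c+d≤N+k =
  subst (λ z → d ≤ k + z) (sym m%N≡c) d≤k+c ,
  subst (λ z → d ≤ k + (N ∸ z)) (sym m%N≡c) d≤k+[N∸c]
  where
  c<N : c < N
  c<N = +-cancelʳ-< d c N (≤-<-trans c+d≤N+k (+-monoʳ-< N k<d))
  m%N≡c : m % N ≡ c
  m%N≡c = trans (cong (_% N) m≡c+rN) (trans ([m+kn]%n≡m%n c r N) (m<n⇒m%n≡m c<N))
  d≤k+[N∸c] : d ≤ k + (N ∸ c)
  d≤k+[N∸c] = begin
    d            ≤⟨ m+n≤o⇒m≤o∸n d (subst (_≤ N + k) (+-comm c d) c+d≤N+k) ⟩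
    N + k ∸ c    ≡⟨ +-∸-comm k (<⇒≤ c<N) ⟩
    N ∸ c + k    ≡⟨ +-comm (N ∸ c) k ⟩
    k + (N ∸ c)  ∎
    where open ≤-Reasoning

module CyclicPacking (p' q : ℕ) where

  p = suc p'
  d = suc (p + q)
  N = suc (2 * p * q + (p + q))
  g = suc (2 * p)
  -- (2p + 1)(2q + 1) = 2N - 1, so h = N - (2q + 1) is the inverse of g modulo N.
  h = suc (2 * p' * q + q + p')

  g*h%N≡1 : (g * h) % N ≡ 1 % N
  g*h%N≡1 = trans (cong (_% N) (g*h≡1+[2p-1]N p' q)) ([m+kn]%n≡m%n 1 (suc (2 * p')) N)
    where
    g*h≡1+[2p-1]N : ∀ p' q → suc (2 * suc p') * suc (2 * p' * q + q + p')
                             ≡ 1 + suc (2 * p') * suc (2 * suc p' * q + (suc p' + q))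
    g*h≡1+[2p-1]N = solve-∀

  σ : Permutation′ N
  σ = scaling N g h g*h%N≡1

  module _ (p≤q : p ≤ q) (q≤1+p : q ≤ suc p) where

    cyclic-gap : ∀ {k} → 0 < k → k < d → d ≤ k + (g * k) % N × d ≤ k + (N ∸ (g * k) % N)
    cyclic-gap {k} 0<k k<d with ≤-<-connex k q
    ... | inj₁ k≤q = cyclic-gap-by-quotient (g * k) 0 (sym (+-identityʳ (g * k))) k<d d≤k+gk gk+d≤N+k
      where
      open ≤-Reasoning
      d≤k+gk : d ≤ k + g * k
      d≤k+gk = begin
        suc (p + q)          ≤⟨ s≤s (+-monoʳ-≤ p q≤1+p) ⟩
        suc p + suc p        ≡⟨ *-identityʳ (suc p + suc p) ⟨
        (suc p + suc p) * 1  ≤⟨ *-monoʳ-≤ (suc p + suc p) 0<k ⟩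
        (suc p + suc p) * k  ≡⟨ distribute p k ⟩
        k + g * k            ∎
        where
        distribute : ∀ p k → (suc p + suc p) * k ≡ k + suc (2 * p) * k
        distribute = solve-∀
      gk+d≤N+k : g * k + d ≤ N + k
      gk+d≤N+k = begin
        g * k + d            ≡⟨ expand-g p q k ⟩
        2 * p * k + (k + d)  ≤⟨ +-monoˡ-≤ (k + d) (*-monoʳ-≤ (2 * p) k≤q) ⟩
        2 * p * q + (k + d)  ≡⟨ collect-N p q k ⟩
        N + k                ∎
        where
        expand-g : ∀ p q k → suc (2 * p) * k + suc (p + q) ≡ 2 * p * k + (k + suc (p + q))
        expand-g = solve-∀
        collect-N : ∀ p q k → 2 * p * q + (k + suc (p + q)) ≡ suc (2 * p * q + (p + q)) + k
        collect-N = solve-∀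
    ... | inj₂ q<k = cyclic-gap-by-quotient (p + g * i) 1 gk≡c+N k<d d≤k+c c+d≤N+k
      where
      open ≤-Reasoning
      i = k ∸ suc q
      k≡ : suc q + i ≡ k
      k≡ = m+[n∸m]≡n q<k
      i<p : i < p
      i<p = +-cancelˡ-< (suc q) i p (begin-strict
        suc q + i    ≡⟨ k≡ ⟩
        k            <⟨ k<d ⟩
        suc (p + q)  ≡⟨ cong suc (+-comm p q) ⟩
        suc q + p    ∎)
      gk≡c+N : g * k ≡ p + g * i + 1 * N
      gk≡c+N = trans (cong (g *_) (sym k≡)) (wrap p q i)
        where
        wrap : ∀ p q i → suc (2 * p) * (suc q + i) ≡ p + suc (2 * p) * i + 1 * suc (2 * p * q + (p + q))
        wrap = solve-∀
      d≤k+c : d ≤ k + (p + g * i)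
      d≤k+c = begin
        suc (p + q)                ≤⟨ m≤m+n (suc (p + q)) (i + g * i) ⟩
        suc (p + q) + (i + g * i)  ≡⟨ regroup p q i ⟩
        suc q + i + (p + g * i)    ≡⟨ cong (_+ (p + g * i)) k≡ ⟩
        k + (p + g * i)            ∎
        where
        regroup : ∀ p q i → suc (p + q) + (i + suc (2 * p) * i) ≡ suc q + i + (p + suc (2 * p) * i)
        regroup = solve-∀
      c+d≤N+k : p + g * i + d ≤ N + k
      c+d≤N+k = begin
        p + g * i + d                    ≡⟨ expand-g p q i ⟩
        (p + 2 * p * i) + (i + d)        ≤⟨ +-monoˡ-≤ (i + d) (+-mono-≤ p≤q (*-monoʳ-≤ (2 * p) i≤q)) ⟩
        (q + 2 * p * q) + (i + d)        ≤⟨ n≤1+n _ ⟩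
        suc ((q + 2 * p * q) + (i + d))  ≡⟨ collect-N p q i ⟩
        N + (suc q + i)                  ≡⟨ cong (N +_) k≡ ⟩
        N + k                            ∎
        where
        i≤q = ≤-trans (<⇒≤ i<p) p≤q
        expand-g : ∀ p q i → p + suc (2 * p) * i + suc (p + q) ≡ (p + 2 * p * i) + (i + suc (p + q))
        expand-g = solve-∀
        collect-N : ∀ p q i → suc ((q + 2 * p * q) + (i + suc (p + q)))
                              ≡ suc (2 * p * q + (p + q)) + (suc q + i)
        collect-N = solve-∀

    σ-separated : Separated d N ⟦ σ ⟧
    σ-separated {x} {x'} x<N x'<N x≢x' =
      subst₂ (λ y y' → d ≤ ∣ x - x' ∣ + ∣ y - y' ∣)
        (sym (⟦scaling⟧ N g h g*h%N≡1 x<N)) (sym (⟦scaling⟧ N g h g*h%N≡1 x'<N))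
        (scaling-separated {N} {d} {g} cyclic-gap x≢x')

    packing : HasPermutedPacking d (2 * p * q + (p + q))
    packing = remove Fin.zero σ ,
              separated⇒permutedPacking (remove Fin.zero σ)
                (remove-zero-separated σ (scaling-zero g h g*h%N≡1) σ-separated)

upper-bound : ∀ {p q} → 0 < p → p ≤ q → q ≤ suc p →
              HasPermutedPacking (suc (p + q)) (2 * p * q + (p + q))
upper-bound {suc p'} {q} _ = CyclicPacking.packing p' q

m≤n≤1+m⇒n≡m∨n≡1+m : ∀ {m n} → m ≤ n → n ≤ suc m → n ≡ m ⊎ n ≡ suc m
m≤n≤1+m⇒n≡m∨n≡1+m m≤n n≤1+m with m≤n⇒m<n∨m≡n n≤1+m
... | inj₁ n<1+m = inj₁ (≤-antisym (s≤s⁻¹ n<1+m) m≤n)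
... | inj₂ n≡1+m = inj₂ n≡1+m

≤∸⇒+≤ : ∀ {a b k} → 0 < k → k ≤ a ∸ b → b + k ≤ a
≤∸⇒+≤ {a} {b} {k} 0<k k≤a∸b with ≤-<-connex b a
... | inj₁ b≤a = subst (_≤ a) (+-comm k b) (m≤o∸n⇒m+n≤o k b≤a k≤a∸b)
... | inj₂ a<b = contradiction (≤-trans 0<k (≤-trans k≤a∸b (≤-reflexive (m≤n⇒m∸n≡0 (<⇒≤ a<b))))) (λ ())

[a∸b]∸[a∸c]≤c∸b : ∀ a b c → (a ∸ b) ∸ (a ∸ c) ≤ c ∸ b
[a∸b]∸[a∸c]≤c∸b a b c = begin
  (a ∸ b) ∸ (a ∸ c)            ≡⟨ ∸-+-assoc a b (a ∸ c) ⟩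
  a ∸ (b + (a ∸ c))            ≤⟨ ∸-monoˡ-≤ (b + (a ∸ c)) (m≤n+m∸n a c) ⟩
  c + (a ∸ c) ∸ (b + (a ∸ c))  ≡⟨ cong₂ _∸_ (+-comm c (a ∸ c)) (+-comm b (a ∸ c)) ⟩
  (a ∸ c) + c ∸ ((a ∸ c) + b)  ≡⟨ [m+n]∸[m+o]≡n∸o (a ∸ c) c b ⟩
  c ∸ b                        ∎
  where open ≤-Reasoning

[a+b]∸[c+e]≤[a∸e]+[b∸c] : ∀ a b c e → (a + b) ∸ (c + e) ≤ (a ∸ e) + (b ∸ c)
[a+b]∸[c+e]≤[a∸e]+[b∸c] a b c e = m≤n+o⇒m∸n≤o (a + b) (c + e) (begin
  a + b                          ≤⟨ +-mono-≤ (m≤n+m∸n a e) (m≤n+m∸n b c) ⟩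
  (e + (a ∸ e)) + (c + (b ∸ c))  ≡⟨ rearrange e (a ∸ e) c (b ∸ c) ⟩
  (c + e) + ((a ∸ e) + (b ∸ c))  ∎)
  where
  open ≤-Reasoning
  rearrange : ∀ w x y z → (w + x) + (y + z) ≡ (y + w) + (x + z)
  rearrange = solve-∀

module Window (p q : ℕ) where

  radius : ℕ → ℕ
  radius j = j ⊓ (p + q ∸ j)

  radius-pairwise-≤ : ∀ {j j'} → j ≤ j' → j' ≤ p + q → ∣ j - j' ∣ + (radius j + radius j') ≤ p + q
  radius-pairwise-≤ {j} {j'} j≤j' j'≤L = begin
    ∣ j - j' ∣ + (radius j + radius j')  ≤⟨ +-monoʳ-≤ ∣ j - j' ∣ (+-mono-≤ (m⊓n≤m j _) (m⊓n≤n j' _)) ⟩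
    ∣ j - j' ∣ + (j + (p + q ∸ j'))      ≡⟨ cong (_+ (j + (p + q ∸ j'))) (m≤n⇒∣m-n∣≡n∸m j≤j') ⟩
    j' ∸ j + (j + (p + q ∸ j'))          ≡⟨ +-assoc (j' ∸ j) j _ ⟨
    j' ∸ j + j + (p + q ∸ j')            ≡⟨ cong (_+ (p + q ∸ j')) (m∸n+n≡m j≤j') ⟩
    j' + (p + q ∸ j')                    ≡⟨ m+[n∸m]≡n j'≤L ⟩
    p + q                                ∎
    where open ≤-Reasoning

  radius-pairwise : ∀ {j j'} → j ≤ p + q → j' ≤ p + q → ∣ j - j' ∣ + (radius j + radius j') ≤ p + q
  radius-pairwise {j} {j'} j≤L j'≤L with ≤-total j j'
  ... | inj₁ j≤j' = radius-pairwise-≤ j≤j' j'≤L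
  ... | inj₂ j'≤j = subst₂ (λ δ w → δ + w ≤ p + q) (∣-∣-comm j' j) (+-comm (radius j') (radius j))
                      (radius-pairwise-≤ j'≤j j≤L)

  module Balanced (p≤q : p ≤ q) (q≤1+p : q ≤ suc p) where

    radius-left : ∀ {j} → j ≤ p → radius j ≡ j
    radius-left {j} j≤p = m≤n⇒m⊓n≡m (m+n≤o⇒m≤o∸n j (+-mono-≤ j≤p (≤-trans j≤p p≤q)))

    radius-right : ∀ i → radius (suc p + i) ≡ q ∸ suc i
    radius-right i = begin
      (suc p + i) ⊓ (p + q ∸ (suc p + i))  ≡⟨ cong (λ z → (suc p + i) ⊓ (p + q ∸ z)) (+-suc p i) ⟨
      (suc p + i) ⊓ (p + q ∸ (p + suc i))  ≡⟨ cong ((suc p + i) ⊓_) ([m+n]∸[m+o]≡n∸o p q (suc i)) ⟩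
      (suc p + i) ⊓ (q ∸ suc i)            ≡⟨ m≥n⇒m⊓n≡n (≤-trans (m∸n≤m q (suc i)) q≤1+p+i) ⟩
      q ∸ suc i                            ∎
      where
      open ≡-Reasoning
      q≤1+p+i = ≤-trans q≤1+p (m≤m+n (suc p) i)

    radius-p : radius p ≡ p
    radius-p = radius-left ≤-refl

    radius-right-< : ∀ {j} → p < j → j ≤ p + q → radius j < q
    radius-right-< {j} p<j j≤L =
      ≤-<-trans (m⊓n≤n j _) (subst (p + q ∸ j <_) (m+n∸m≡n p q) (∸-monoʳ-< p<j j≤L))

    radius≤p : ∀ {j} → j ≤ p + q → radius j ≤ p
    radius≤p {j} j≤L with ≤-<-connex j p
    ... | inj₁ j≤p = ≤-trans (m⊓n≤m j _) j≤p
    ... | inj₂ p<j = s≤s⁻¹ (≤-trans (radius-right-< p<j j≤L) q≤1+p)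

    radius<q : ∀ {j} → j ≤ p + q → j ≢ p → radius j < q
    radius<q {j} j≤L j≢p with ≤-<-connex j p
    ... | inj₁ j≤p = ≤-<-trans (m⊓n≤m j _) (<-≤-trans (≤∧≢⇒< j≤p j≢p) p≤q)
    ... | inj₂ p<j = radius-right-< p<j j≤L

    ∑radius : ∑[ j < suc (p + q) ] suc (radius j + radius j) ≡ suc p * suc p + q * q
    ∑radius = begin
      ∑[ j < suc p + q ] suc (radius j + radius j)
        ≡⟨ ∑-split (suc p) q (λ j → suc (radius j + radius j)) ⟩
      ∑[ j < suc p ] suc (radius j + radius j) + ∑[ i < q ] suc (radius (suc p + i) + radius (suc p + i))
        ≡⟨ cong₂ _+_ (∑-cong (suc p) (λ j<1+p → cong (λ w → suc (w + w)) (radius-left (s≤s⁻¹ j<1+p))))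
                     (∑-cong q (λ {i} _ → cong (λ w → suc (w + w)) (radius-right i))) ⟩
      ∑[ j < suc p ] suc (j + j) + ∑[ i < q ] suc ((q ∸ suc i) + (q ∸ suc i))
        ≡⟨ cong₂ _+_ (∑-odd (suc p)) (trans (∑-reverse q (λ j → suc (j + j))) (∑-odd q)) ⟩
      suc p * suc p + q * q
        ∎
      where open ≡-Reasoning

    ∑radius≡ : ∑[ j < suc (p + q) ] suc (radius j + radius j) ≡ suc (2 * p * q + (p + q))
    ∑radius≡ = trans ∑radius (squares (m≤n≤1+m⇒n≡m∨n≡1+m p≤q q≤1+p))
      where
      squares : q ≡ p ⊎ q ≡ suc p → suc p * suc p + q * q ≡ suc (2 * p * q + (p + q))
      squares (inj₁ refl) = odd p
        where
        odd : ∀ p → suc p * suc p + p * p ≡ suc (2 * p * p + (p + p))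
        odd = solve-∀
      squares (inj₂ refl) = even p
        where
        even : ∀ p → suc p * suc p + suc p * suc p ≡ suc (2 * p * suc p + (p + suc p))
        even = solve-∀

    protrusion-bound : ℕ → ℕ
    protrusion-bound y = (p ∸ y) + (q ∸ suc y)

    ∑protrusion-bound : ∑[ y < q ] protrusion-bound y ≡ q * p
    ∑protrusion-bound = begin
      ∑[ y < q ] ((p ∸ y) + (q ∸ suc y))           ≡⟨ ∑-distrib-+ q (p ∸_) (λ y → q ∸ suc y) ⟩
      ∑[ y < q ] (p ∸ y) + ∑[ y < q ] (q ∸ suc y)  ≡⟨ cong (∑[ y < q ] (p ∸ y) +_) (∑-reverse q (λ y → y)) ⟩
      ∑[ y < q ] (p ∸ y) + ∑[ y < q ] y            ≡⟨ ∑-distrib-+ q (p ∸_) (λ y → y) ⟨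
      ∑[ y < q ] ((p ∸ y) + y)                     ≡⟨ ∑-cong q (λ y<q → m∸n+n≡m (s≤s⁻¹ (≤-trans y<q q≤1+p))) ⟩
      ∑[ y < q ] p                                 ≡⟨ ∑-const q p ⟩
      q * p                                        ∎
      where open ≡-Reasoning

    count-protrusions : ∀ c y T → ∑[ τ < T ] 𝟙 (suc y ≤? radius (c ∸ τ)) ≤ protrusion-bound y
    count-protrusions c y T = begin
      ∑[ τ < T ] 𝟙 (suc y ≤? radius (c ∸ τ))  ≤⟨ ∑-mono-≤ T (λ {τ} _ → in-interval τ) ⟩
      ∑[ τ < T ] 𝟙[ c ∸ r ≤ τ < c ∸ y ]       ≤⟨ ∑-𝟙[≤<]-≤ (c ∸ r) (c ∸ y) T ⟩
      (c ∸ y) ∸ (c ∸ r)                       ≤⟨ [a∸b]∸[a∸c]≤c∸b c y r ⟩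
      p + q ∸ suc y ∸ y                       ≡⟨ ∸-+-assoc (p + q) (suc y) y ⟩
      p + q ∸ (suc y + y)                     ≤⟨ [a+b]∸[c+e]≤[a∸e]+[b∸c] p q (suc y) y ⟩
      protrusion-bound y                      ∎
      where
      open ≤-Reasoning
      r = p + q ∸ suc y
      in-interval : ∀ τ → 𝟙 (suc y ≤? radius (c ∸ τ)) ≤ 𝟙[ c ∸ r ≤ τ < c ∸ y ]
      in-interval τ with suc y ≤? radius (c ∸ τ)
      ... | no  _   = z≤n
      ... | yes y<w = ≤-reflexive (sym (𝟙[≤<]-in c∸r≤τ τ<c∸y))
        where
        τ<c∸y : τ < c ∸ y
        τ<c∸y = m+n≤o⇒m≤o∸n (suc τ)
                  (subst (_≤ c) (+-suc τ y) (≤∸⇒+≤ {c} {τ} z<s (≤-trans y<w (m⊓n≤m _ _))))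
        c∸τ≤r : c ∸ τ ≤ r
        c∸τ≤r = m+n≤o⇒m≤o∸n (c ∸ τ) (≤∸⇒+≤ {p + q} {c ∸ τ} z<s (≤-trans y<w (m⊓n≤n _ _)))
        c∸r≤τ : c ∸ r ≤ τ
        c∸r≤τ = m≤n+o⇒m∸n≤o c r (begin
          c            ≤⟨ m≤n+m∸n c τ ⟩
          τ + (c ∸ τ)  ≤⟨ +-monoʳ-≤ τ c∸τ≤r ⟩
          τ + r        ≡⟨ +-comm τ r ⟩
          r + τ        ∎)

module LowerBound {p q n : ℕ} (0<p : 0 < p) (p≤q : p ≤ q) (q≤1+p : q ≤ suc p) (2≤n : 2 ≤ n)
                  (Y X : ℕ → ℕ) (Y-< : ∀ {x} → x < n → Y x < n)
                  (X-Y : ∀ {x} → x < n → X (Y x) ≡ x)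
                  (separated : Separated (suc (p + q)) n Y)
                  where

  open Window p q
  open Balanced p≤q q≤1+p

  d≤n : suc (p + q) ≤ n
  d≤n = begin
    suc (p + q)        ≤⟨ separated {0} {1} (<-≤-trans z<s 2≤n) 2≤n (λ ()) ⟩
    suc ∣ Y 0 - Y 1 ∣  ≤⟨ s≤s (∣m-n∣≤m⊔n (Y 0) (Y 1)) ⟩
    suc (Y 0 ⊔ Y 1)    ≤⟨ ⊔-lub (Y-< (<-≤-trans z<s 2≤n)) (Y-< 2≤n) ⟩
    n                  ∎
    where open ≤-Reasoning

  window-packing : ∀ τ r L U → τ + suc (p + q) ≤ n →
                   (∀ {j} → j < suc (p + q) → L + radius j ≤ r + Y (τ + j)) →
                   (∀ {j} → j < suc (p + q) → r + Y (τ + j) + radius j < U) →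
                   suc (2 * p * q + (p + q)) ≤ U ∸ L
  window-packing τ r L U τ+d≤n above below =
    subst (_≤ U ∸ L) ∑radius≡
      (balls-packing (suc (p + q)) L U (λ j → r + Y (τ + j)) radius above below apart)
    where
    column< : ∀ {j} → j < suc (p + q) → τ + j < n
    column< j<d = <-≤-trans (+-monoʳ-< τ j<d) τ+d≤n
    apart : ∀ {i j} → i < suc (p + q) → j < suc (p + q) → i ≢ j →
            radius i + radius j < ∣ r + Y (τ + i) - r + Y (τ + j) ∣
    apart {i} {j} i<d j<d i≢j =
      subst (radius i + radius j <_) (sym (∣m+n-m+o∣≡∣n-o∣ r (Y (τ + i)) (Y (τ + j))))
        (+-cancelˡ-< ∣ i - j ∣ (radius i + radius j) _ (begin-strict
          ∣ i - j ∣ + (radius i + radius j)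
            ≤⟨ radius-pairwise (s≤s⁻¹ i<d) (s≤s⁻¹ j<d) ⟩
          p + q
            <⟨ n<1+n (p + q) ⟩
          suc (p + q)
            ≤⟨ separated (column< i<d) (column< j<d) (i≢j ∘ +-cancelˡ-≡ τ i j) ⟩
          ∣ τ + i - τ + j ∣ + ∣ Y (τ + i) - Y (τ + j) ∣
            ≡⟨ cong (_+ ∣ Y (τ + i) - Y (τ + j) ∣) (∣m+n-m+o∣≡∣n-o∣ τ i j) ⟩
          ∣ i - j ∣ + ∣ Y (τ + i) - Y (τ + j) ∣
            ∎))
      where open ≤-Reasoning

  private
    in-first-window : ∀ {j} → j < suc (p + q) → j < n
    in-first-window j<d = <-≤-trans j<d d≤n

    from-window : suc (2 * p * q + (p + q)) ≤ n + (p + q) ∸ 1 → 2 * p * q + 2 ≤ n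
    from-window N≤ = +-cancelʳ-≤ (p + q) (2 * p * q + 2) n (begin
      2 * p * q + 2 + (p + q)        ≡⟨ shift p q ⟩
      suc (2 * p * q + (p + q)) + 1  ≤⟨ m≤o∸n⇒m+n≤o _ (≤-trans (<-≤-trans z<s 2≤n) (m≤m+n n (p + q))) N≤ ⟩
      n + (p + q)                    ∎)
      where
      open ≤-Reasoning
      shift : ∀ p q → 2 * p * q + 2 + (p + q) ≡ suc (2 * p * q + (p + q)) + 1
      shift = solve-∀

    2pq+2≤n-if-< : suc (Y p) < n → 2 * p * q + 2 ≤ n
    2pq+2≤n-if-< 1+Yp<n = from-window (window-packing 0 (suc p) 1 (n + (p + q)) d≤n above below)
      where
      open ≤-Reasoning
      above : ∀ {j} → j < suc (p + q) → 1 + radius j ≤ suc p + Y j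
      above j<d = s≤s (≤-trans (radius≤p (s≤s⁻¹ j<d)) (m≤m+n p _))
      below : ∀ {j} → j < suc (p + q) → suc p + Y j + radius j < n + (p + q)
      below {j} j<d with j ≟ p
      ... | yes refl = begin-strict
        suc p + Y p + radius p  ≡⟨ cong (suc p + Y p +_) radius-p ⟩
        suc p + Y p + p         ≡⟨ rearrange p (Y p) ⟩
        suc (Y p) + (p + p)     <⟨ +-monoˡ-< (p + p) 1+Yp<n ⟩
        n + (p + p)             ≤⟨ +-monoʳ-≤ n (+-monoʳ-≤ p p≤q) ⟩
        n + (p + q)             ∎
        where
        rearrange : ∀ p y → suc p + y + p ≡ suc y + (p + p)
        rearrange = solve-∀
      ... | no  j≢p = begin
        suc (suc p + Y j + radius j)    ≡⟨ rearrange p (Y j) (radius j) ⟩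
        p + suc (Y j) + suc (radius j)  ≤⟨ +-mono-≤ (+-monoʳ-≤ p (Y-< (in-first-window j<d)))
                                                     (radius<q (s≤s⁻¹ j<d) j≢p) ⟩
        p + n + q                       ≡⟨ rearrange′ p n q ⟩
        n + (p + q)                     ∎
        where
        rearrange : ∀ p y w → suc (suc p + y + w) ≡ p + suc y + suc w
        rearrange = solve-∀
        rearrange′ : ∀ p n q → p + n + q ≡ n + (p + q)
        rearrange′ = solve-∀

    2pq+2≤n-if-≡ : suc (Y p) ≡ n → 2 * p * q + 2 ≤ n
    2pq+2≤n-if-≡ 1+Yp≡n = from-window (window-packing 0 q 1 (n + (p + q)) d≤n above below)
      where
      open ≤-Reasoning
      above : ∀ {j} → j < suc (p + q) → 1 + radius j ≤ q + Y j
      above {j} j<d with j ≟ p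
      ... | yes refl = begin
        suc (radius p)  ≡⟨ cong suc radius-p ⟩
        suc p           ≡⟨ +-comm 1 p ⟩
        p + 1           ≤⟨ +-mono-≤ p≤q (s≤s⁻¹ (subst (2 ≤_) (sym 1+Yp≡n) 2≤n)) ⟩
        q + Y p         ∎
      ... | no  j≢p = ≤-trans (radius<q (s≤s⁻¹ j<d) j≢p) (m≤m+n q (Y j))
      below : ∀ {j} → j < suc (p + q) → q + Y j + radius j < n + (p + q)
      below {j} j<d = begin-strict
        q + Y j + radius j    ≡⟨ rearrange q (Y j) (radius j) ⟩
        Y j + (radius j + q)  <⟨ +-monoˡ-< (radius j + q) (Y-< (in-first-window j<d)) ⟩
        n + (radius j + q)    ≤⟨ +-monoʳ-≤ n (+-monoˡ-≤ q (radius≤p (s≤s⁻¹ j<d))) ⟩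
        n + (p + q)           ∎
        where
        rearrange : ∀ q y w → q + y + w ≡ y + (w + q)
        rearrange = solve-∀

  2pq+2≤n : 2 * p * q + 2 ≤ n
  2pq+2≤n with <-≤-connex (suc (Y p)) n
  ... | inj₁ 1+Yp<n = 2pq+2≤n-if-< 1+Yp<n
  ... | inj₂ n≤1+Yp = 2pq+2≤n-if-≡ (≤-antisym (Y-< (in-first-window (s≤s (m≤m+n p q)))) n≤1+Yp)

  -- The tile of row y lies in column X y, at offset X y ∸ τ in window τ; the radius of
  -- that offset is 0 whenever the column is outside the window.
  protruding : ℕ → ℕ
  protruding τ = ∑[ y < q ] 𝟙 (suc y ≤? radius (X y ∸ τ))
               + ∑[ b < q ∸ 1 ] 𝟙 (suc (suc b) ≤? radius (X (n ∸ suc b) ∸ τ))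

  ¬protruding⇒fits : ∀ {τ} → protruding τ ≡ 0 → ∀ {j} → j < suc (p + q) → τ + j < n →
                     radius j ≤ Y (τ + j) × Y (τ + j) + radius j ≤ n
  ¬protruding⇒fits {τ} none {j} j<d x<n = fits-below , fits-above
    where
    x = τ + j
    clear-below : ∀ {y} → y < q → ¬ suc y ≤ radius (X y ∸ τ)
    clear-below y<q y<w =
      0≢1+n (trans (sym (∑≡0⇒≡0 q (m+n≡0⇒m≡0 _ none) y<q)) (𝟙-yes (_ ≤? _) y<w))
    clear-above : ∀ {b} → b < q ∸ 1 → ¬ suc (suc b) ≤ radius (X (n ∸ suc b) ∸ τ)
    clear-above b<q∸1 b<w =
      0≢1+n (trans (sym (∑≡0⇒≡0 (q ∸ 1) (m+n≡0⇒n≡0 _ none) b<q∸1)) (𝟙-yes (_ ≤? _) b<w))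
    w≤q : radius j ≤ q
    w≤q = ≤-trans (radius≤p (s≤s⁻¹ j<d)) p≤q
    radius-X : ∀ {y} → y ≡ Y x → radius (X y ∸ τ) ≡ radius j
    radius-X refl = cong radius (trans (cong (_∸ τ) (X-Y x<n)) (m+n∸m≡n τ j))
    fits-below : radius j ≤ Y x
    fits-below with ≤-<-connex (radius j) (Y x)
    ... | inj₁ w≤Y = w≤Y
    ... | inj₂ Y<w = contradiction (subst (suc (Y x) ≤_) (sym (radius-X refl)) Y<w)
                                   (clear-below (<-≤-trans Y<w w≤q))
    fits-above : Y x + radius j ≤ n
    fits-above with ≤-<-connex (Y x + radius j) n
    ... | inj₁ fits = fits
    ... | inj₂ n<Y+w = contradiction (subst (suc (suc b) ≤_) (sym (radius-X n∸[1+b]≡Y)) 2+b≤w)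
                                     (clear-above (∸-monoˡ-≤ 1 (≤-trans 2+b≤w w≤q)))
      where
      b = n ∸ suc (Y x)
      1+b≡n∸Y : suc b ≡ n ∸ Y x
      1+b≡n∸Y = sym (+-∸-assoc 1 (Y-< x<n))
      n∸[1+b]≡Y : n ∸ suc b ≡ Y x
      n∸[1+b]≡Y = trans (cong (n ∸_) 1+b≡n∸Y) (m∸[m∸n]≡n (<⇒≤ (Y-< x<n)))
      2+b≤w : suc (suc b) ≤ radius j
      2+b≤w = subst (λ k → suc k ≤ radius j) (sym 1+b≡n∸Y)
                (+-cancelˡ-< (Y x) (n ∸ Y x) (radius j)
                  (subst (_< Y x + radius j) (sym (m+[n∸m]≡n (<⇒≤ (Y-< x<n)))) n<Y+w))

  ∑protruding≤ : ∀ T → ∑[ τ < T ] protruding τ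
                       ≤ ∑[ y < q ] protrusion-bound y + ∑[ b < q ∸ 1 ] protrusion-bound (suc b)
  ∑protruding≤ T = begin
    ∑[ τ < T ] protruding τ
      ≡⟨ ∑-distrib-+ T (λ τ → ∑[ y < q ] below τ y) (λ τ → ∑[ b < q ∸ 1 ] above τ b) ⟩
    ∑[ τ < T ] ∑[ y < q ] below τ y + ∑[ τ < T ] ∑[ b < q ∸ 1 ] above τ b
      ≡⟨ cong₂ _+_ (∑-comm T q below) (∑-comm T (q ∸ 1) above) ⟩
    ∑[ y < q ] ∑[ τ < T ] below τ y + ∑[ b < q ∸ 1 ] ∑[ τ < T ] above τ b
      ≤⟨ +-mono-≤ (∑-mono-≤ q (λ {y} _ → count-protrusions (X y) y T))
                  (∑-mono-≤ (q ∸ 1) (λ {b} _ → count-protrusions (X (n ∸ suc b)) (suc b) T)) ⟩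
    ∑[ y < q ] protrusion-bound y + ∑[ b < q ∸ 1 ] protrusion-bound (suc b)
      ∎
    where
    open ≤-Reasoning
    below above : ℕ → ℕ → ℕ
    below τ y = 𝟙 (suc y ≤? radius (X y ∸ τ))
    above τ b = 𝟙 (suc (suc b) ≤? radius (X (n ∸ suc b) ∸ τ))

  few-protrusions : suc (∑[ y < q ] protrusion-bound y + ∑[ b < q ∸ 1 ] protrusion-bound (suc b))
                    ≤ n ∸ (p + q)
  few-protrusions = m+n≤o⇒m≤o∸n (suc (S₀ + S₁)) (begin
    suc (S₀ + S₁) + (p + q)            ≡⟨ cong (λ k → suc (S₀ + S₁) + (p + k)) 1+[q∸1]≡q ⟨
    suc (S₀ + S₁) + (p + suc (q ∸ 1))  ≡⟨ rearrange S₀ S₁ p (q ∸ 1) ⟩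
    2 + S₀ + (p + (q ∸ 1) + S₁)        ≡⟨ cong₂ (λ a b → 2 + a + b) ∑protrusion-bound head+S₁≡qp ⟩
    2 + q * p + q * p                  ≡⟨ double p q ⟩
    2 * p * q + 2                      ≤⟨ 2pq+2≤n ⟩
    n                                  ∎)
    where
    open ≤-Reasoning
    S₀ = ∑[ y < q ] protrusion-bound y
    S₁ = ∑[ b < q ∸ 1 ] protrusion-bound (suc b)
    1+[q∸1]≡q : suc (q ∸ 1) ≡ q
    1+[q∸1]≡q = sym (+-∸-assoc 1 (≤-trans 0<p p≤q))
    head+S₁≡qp : p + (q ∸ 1) + S₁ ≡ q * p
    head+S₁≡qp = trans (sym (∑-head (q ∸ 1) protrusion-bound))
                       (trans (cong (λ k → ∑< k protrusion-bound) 1+[q∸1]≡q) ∑protrusion-bound)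
    rearrange : ∀ a b p q′ → suc (a + b) + (p + suc q′) ≡ 2 + a + (p + q′ + b)
    rearrange = solve-∀
    double : ∀ p q → 2 + q * p + q * p ≡ 2 * p * q + 2
    double = solve-∀

  lower-bound : 2 * p * q + (p + q) ≤ n
  lower-bound with ∑<k⇒∃≡0 (n ∸ (p + q)) (<-≤-trans (s≤s (∑protruding≤ (n ∸ (p + q)))) few-protrusions)
  ... | τ , τ<n∸[p+q] , none = s≤s⁻¹ (window-packing τ 0 0 (suc n) τ+d≤n
                                  (λ j<d → proj₁ (fits j<d)) (λ j<d → s≤s (proj₂ (fits j<d))))
    where
    τ+d≤n : τ + suc (p + q) ≤ n
    τ+d≤n = subst (_≤ n) (sym (+-suc τ (p + q))) (m≤o∸n⇒m+n≤o (suc τ) (<⇒≤ d≤n) τ<n∸[p+q])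
    fits : ∀ {j} → j < suc (p + q) → radius j ≤ Y (τ + j) × Y (τ + j) + radius j ≤ n
    fits j<d = ¬protruding⇒fits none j<d (<-≤-trans (+-monoʳ-< τ j<d) τ+d≤n)

no-smaller-packing : ∀ {p q n} → 0 < p → p ≤ q → q ≤ suc p → 2 ≤ n →
                     HasPermutedPacking (suc (p + q)) n → 2 * p * q + (p + q) ≤ n
no-smaller-packing 0<p p≤q q≤1+p 2≤n (σ , packing) =
  LowerBound.lower-bound 0<p p≤q q≤1+p 2≤n ⟦ σ ⟧ ⟦ flip σ ⟧ (⟦⟧-< σ) (⟦flip⟧-⟦⟧ σ)
    (permutedPacking⇒separated σ packing)

halves : ∀ k → ∃[ p ] ∃[ q ] p + q ≡ k × p ≤ q × q ≤ suc p
halves zero    = 0 , 0 , refl , z≤n , z≤n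
halves (suc k) with halves k
... | p , q , p+q≡k , p≤q , q≤1+p =
  q , suc p , trans (+-suc q p) (cong suc (trans (+-comm q p) p+q≡k)) , q≤1+p , s≤s p≤q

halves-positive : ∀ {p q} → p ≤ q → q ≤ suc p → 2 < suc (p + q) → 0 < p
halves-positive {zero}  _ q≤1 2<1+q = contradiction 2<1+q (<⇒≱ (s≤s (s≤s q≤1)))
halves-positive {suc _} _ _   _     = z<s

ceilHalfSqMinusOne-halves : ∀ {p q} → p ≤ q → q ≤ suc p →
                            ceilHalfSqMinusOne (suc (p + q)) ≡ 2 * p * q + (p + q)
ceilHalfSqMinusOne-halves {p} {q} p≤q q≤1+p with m≤n≤1+m⇒n≡m∨n≡1+m p≤q q≤1+p
... | inj₁ refl = trans (cong (λ m → (m ∸ 1) / 2) (odd-square p)) (m*n/n≡m M 2)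
  where
  M = 2 * p * p + (p + p)
  odd-square : ∀ p → suc (p + p) * suc (p + p) ≡ suc ((2 * p * p + (p + p)) * 2)
  odd-square = solve-∀
... | inj₂ refl = trans (cong (λ m → (m ∸ 1) / 2) (even-square p)) half-odd
  where
  M = 2 * p * suc p + (p + suc p)
  even-square : ∀ p → suc (p + suc p) * suc (p + suc p) ≡ 2 + (2 * p * suc p + (p + suc p)) * 2
  even-square = solve-∀
  half-odd : (1 + M * 2) / 2 ≡ M
  half-odd = trans (+-distrib-/ 1 (M * 2) (subst (λ r → 1 + r < 2) (sym (m*n%n≡0 M 2)) ≤-refl))
                   (m*n/n≡m M 2)

corollary4p4 : (d : ℕ) → 2 < d →
    (2 ≤ ceilHalfSqMinusOne d)
    × HasPermutedPacking d (ceilHalfSqMinusOne d)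
    × ((n : ℕ) → 2 ≤ n → n < ceilHalfSqMinusOne d → ¬ HasPermutedPacking d n)
corollary4p4 zero    ()
corollary4p4 (suc k) 2<d with halves k
... | p , q , refl , p≤q , q≤1+p rewrite ceilHalfSqMinusOne-halves p≤q q≤1+p =
  ≤-trans (+-mono-≤ 0<p 0<q) (m≤n+m (p + q) (2 * p * q)) ,
  upper-bound 0<p p≤q q≤1+p ,
  λ n 2≤n n<M packing → <⇒≱ n<M (no-smaller-packing 0<p p≤q q≤1+p 2≤n packing)
  where
  0<p : 0 < p
  0<p = halves-positive p≤q q≤1+p 2<d
  0<q : 0 < q
  0<q = ≤-trans 0<p p≤q
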